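{- Let $n\ge3$ be an integer. A spiky function $\lambda:2^{E_n}\to\mathbb N$ is the connectivity function of a matroid on $E_n$ if and only if there is an independent set $I$ of the graph $H_n$ such that for every transversal $X\in\mathcal T_n$ we have $\lambda(X)=n-|I\cap\{X,E_n-X\}|$.
   Context: Let $L_i=\{x_i,y_i\}$ ($i=1,\dots,n$) be pairwise disjoint two-element sets and $E_n=L_1\cup\dots\cup L_n$. A transversal is a set $\{z_1,\dots,z_n\}$ with $z_i\in\{x_i,y_i\}$; $\mathcal T_n$ is the set of transversals. $H_n$ is the graph with vertex set $\mathcal T_n$ in which two transversals are adjacent exactly when they differ in exactly one element (so $H_n$ is the $n$-dimensional hypercube); an independent set is a set of pairwise non-adjacent vertices. For $X\subseteq E_n$ let $l(X)$ be the number of sets $L_i$ meeting $X$. Define $r_n$ on $2^{E_n}-\mathcal T_n$ by: if $X$ includes no $L_i$ and is disjoint from some $L_i$, $r_n(X)=|X|$; if $X$ includes some $L_i$ and is disjoint from some other $L_j$, $r_n(X)=l(X)+1$; if $X$ includes some $L_i$ and meets all $L_j$, $r_n(X)=n$. Let $\lambda_n(X)=r_n(X)+r_n(E_n-X)-n$ for $X\notin\mathcal T_n$. A function $\lambda:2^{E_n}\to\mathbb N$ is spiky if it is symmetric ($\lambda(X)=\lambda(E_n-X)$), agrees with $\lambda_n$ off $\mathcal T_n$, takes values in $\{n-2,n-1,n\}$ on $\mathcal T_n$, and satisfies $\lambda(X)+\lambda(Y)\ge2n-2$ for transversals $X,Y$ differing in exactly one element. The connectivity function of a matroid $M$ on $E$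 with rank function $r$ is $\mu_M(X)=r(X)+r(E-X)-r(E)$. -}

module Defs where

open import Data.Nat using (ℕ; _+_; _∸_; _≤_)
open import Data.Bool using (Bool; true; false; if_then_else_; _∨_)
open import Data.Fin using (Fin; _↑ˡ_; _↑ʳ_)
open import Data.Fin.Subset using (Subset; _∈_; _∉_; _⊆_; _∪_; _∩_; _─_; ∁; ⊤; ∣_∣)
open import Data.Fin.Subset.Properties using (_∈?_)
open import Data.Fin.Properties using (any?)
open import Data.Vec using (tabulate; lookup)
open import Data.Product using (_×_; ∃; _,_)
open import Data.Sum using (_⊎_)
open import Relation.Nullary using (¬_; yes; no; Dec)
open import Relation.Nullary.Decidable using (_×-dec_; ¬?)
open import Relation.Binary.PropositionalEquality using (_≡_)

record Matroid (m : ℕ) : Set where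
  field
    rank       : Subset m → ℕ
    rank-card  : ∀ X → rank X ≤ ∣ X ∣
    rank-mono  : ∀ X Y → X ⊆ Y → rank X ≤ rank Y
    rank-submod : ∀ X Y → rank (X ∪ Y) + rank (X ∩ Y) ≤ rank X + rank Y

connectivity : ∀ {m} → Matroid m → Subset m → ℕ
connectivity M X = rank X + rank (∁ X) ∸ rank ⊤
  where open Matroid M

-- The ground set E_n = Fin (n + n), with L_i = {x_i , y_i},
-- x_i = i  and  y_i = n + i.

Sub : ℕ → Set
Sub n = Subset (n + n)

x : ∀ (n : ℕ) → Fin n → Fin (n + n)
x n i = i ↑ˡ n

y : ∀ (n : ℕ) → Fin n → Fin (n + n)
y n i = n ↑ʳ i

Includes : ∀ n → Sub n → Fin n → Set
Includes n X i = (x n i ∈ X) × (y n i ∈ X)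

DisjointFrom : ∀ n → Sub n → Fin n → Set
DisjointFrom n X i = (x n i ∉ X) × (y n i ∉ X)

includes? : ∀ n (X : Sub n) (i : Fin n) → Dec (Includes n X i)
includes? n X i = (x n i ∈? X) ×-dec (y n i ∈? X)

disjointFrom? : ∀ n (X : Sub n) (i : Fin n) → Dec (DisjointFrom n X i)
disjointFrom? n X i = ¬? (x n i ∈? X) ×-dec ¬? (y n i ∈? X)

Transversal : ∀ n → Sub n → Set
Transversal n X = ∀ i → ((x n i ∈ X) × (y n i ∉ X)) ⊎ ((x n i ∉ X) × (y n i ∈ X))

l : ∀ n → Sub n → ℕ
l n X = ∣ tabulate {n = n} (λ i → lookup X (x n i) ∨ lookup X (y n i)) ∣

-- r_n.  It is only specified (and only used) off the transversals; on
-- transversals (the case "includes no L_i and is disjoint from no L_i")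
-- we put the irrelevant value n.
r : ∀ n → Sub n → ℕ
r n X with any? (includes? n X) | any? (disjointFrom? n X)
... | no  _ | yes _ = ∣ X ∣
... | yes _ | yes _ = l n X + 1
... | yes _ | no  _ = n
... | no  _ | no  _ = n

-- λ_n(X) = r_n(X) + r_n(E_n − X) − n   (used only for X ∉ T_n)
λn : ∀ n → Sub n → ℕ
λn n X = r n X + r n (∁ X) ∸ n

Adjacent : ∀ n → Sub n → Sub n → Set
Adjacent n X Y = Transversal n X × Transversal n Y × (∣ X ─ Y ∣ ≡ 1)

record Spiky (n : ℕ) (λ′ : Sub n → ℕ) : Set where
  field
    symmetric   : ∀ X → λ′ X ≡ λ′ (∁ X)
    agrees      : ∀ X → ¬ Transversal n X → λ′ X ≡ λn n X
    values      : ∀ X → Transversal n X → (λ′ X ≡ n ∸ 2) ⊎ (λ′ X ≡ n ∸ 1) ⊎ (λ′ X ≡ n)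
    adjacentSum : ∀ X Y → Adjacent n X Y → (n + n) ∸ 2 ≤ λ′ X + λ′ Y

-- a set of vertices of H_n (vertices are transversals), given by its
-- characteristic function, which is independent in H_n
IsIndependent : ∀ n → (Sub n → Bool) → Set
IsIndependent n I =
  (∀ X → I X ≡ true → Transversal n X) ×
  (∀ X Y → I X ≡ true → I Y ≡ true → ¬ Adjacent n X Y)

-- |I ∩ {X, E_n − X}|  (X ≠ E_n − X whenever n ≥ 1)
countIn : ∀ n → (Sub n → Bool) → Sub n → ℕ
countIn n I X = (if I X then 1 else 0) + (if I (∁ X) then 1 else 0)

-- Write E_n = L_1 ∪ … ∪ L_n with legs L_i = {x_i, y_i}; for X ⊆ E_n let
-- l X be the number of legs met by X and k X the number of legs included in
-- X, so that |X| = l X + k X.  The function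
--     g X = min (l X + min (1, k X), n)
-- is the rank function of the free spike (without tip): it agrees with r_n
-- off the transversals and equals n on them.
--
-- Sufficiency.  Transversals are free bases of the free spike, and the members
-- of an independent set I of H_n pairwise differ in at least two elements.
-- A general tightening lemma then shows that lowering the rank of every
-- member of I by one gives a matroid; its connectivity function is λn off the
-- transversals and n - |I ∩ {X, E_n - X}| on a transversal X.
--
-- Necessity.  If λ′ = μ_M, every set including no leg and missing some leg has
-- connectivity equal to its size, hence is independent in M.  A set W
-- including one leg and missing another shows r(M) = n, so transversals have
-- rank n - 1 or n.  Take I = the transversals of rank n - 1.  If two adjacent
-- transversals were in I, submodularity would give r(X ∪ Y) ≤ n - 1, while
-- the connectivity of X ∪ Y (that of its complement, a partial transversal
-- of size n - 1) forces r(X ∪ Y) = n.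
module Submission where

open import Defs
open import Data.Nat using (ℕ; zero; suc; _≤_; _<_; _∸_; _+_; _⊓_; z≤n; s≤s; _<?_)
open import Data.Nat.Properties
open import Algebra.Properties.CommutativeSemigroup +-commutativeSemigroup using (interchange)
open import Data.Bool using (Bool; true; false; if_then_else_; _∨_; _∧_; not)
open import Data.Fin using (Fin; zero; suc; fromℕ<)
open import Data.Fin.Subset
  using (Subset; inside; outside; _∈_; _∉_; _⊆_; _∪_; _∩_; _─_; ∁; ⊤; ⊥; ⁅_⁆; ∣_∣)
open import Data.Fin.Subset.Properties
open import Data.Vec using ([]; _∷_; _++_; take; drop; lookup)
open import Data.Vec.Properties
  using (take++drop≡id; take-zipWith; drop-zipWith; take-map; drop-map; ++-injectiveˡ; ++-injectiveʳ;
         lookup-++ˡ; lookup-++ʳ; []=⇒lookup; lookup⇒[]=;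
         tabulate-cong; tabulate∘lookup; lookup-zipWith)
open import Algebra.Lattice.Bundles using (BooleanAlgebra)
open import Data.Product using (Σ; _×_; _,_; proj₁; proj₂; ∃) renaming (map to map-×)
open import Data.Sum using (inj₁; inj₂; [_,_]) renaming (map to map-⊎)
open import Function using (id; _∘_)
open import Function.Bundles using (_⇔_; mk⇔)
open import Relation.Nullary using (¬_; Dec; yes; no; contradiction)
open import Relation.Nullary.Decidable using (_×-dec_; _⊎-dec_; ¬?; ⌊_⌋)
open import Data.Fin.Properties using (all?; any?)
open import Relation.Binary.PropositionalEquality
  using (_≡_; _≢_; refl; sym; trans; cong; cong₂; subst; subst₂; module ≡-Reasoning)

-- Truncating a monotone submodular function at height c keeps it submodular
-- (a, b, p, q stand for the values at X ∪ Y, X ∩ Y, X, Y).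
⊓-submodular : ∀ {a b p q} c → a + b ≤ p + q → b ≤ p → b ≤ q → a ⊓ c + b ⊓ c ≤ p ⊓ c + q ⊓ c
⊓-submodular {a} {b} {p} {q} c ab≤pq b≤p b≤q with ≤-total c p | ≤-total c q
... | inj₁ c≤p | inj₁ c≤q rewrite m≥n⇒m⊓n≡n c≤p | m≥n⇒m⊓n≡n c≤q =
  +-mono-≤ (m⊓n≤n a c) (m⊓n≤n b c)
... | inj₁ c≤p | inj₂ q≤c rewrite m≥n⇒m⊓n≡n c≤p | m≤n⇒m⊓n≡m q≤c =
  +-mono-≤ (m⊓n≤n a c) (≤-trans (m⊓n≤m b c) b≤q)
... | inj₂ p≤c | inj₁ c≤q rewrite m≤n⇒m⊓n≡m p≤c | m≥n⇒m⊓n≡n c≤q =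
  subst (a ⊓ c + b ⊓ c ≤_) (+-comm c p) (+-mono-≤ (m⊓n≤n a c) (≤-trans (m⊓n≤m b c) b≤p))
... | inj₂ p≤c | inj₂ q≤c rewrite m≤n⇒m⊓n≡m p≤c | m≤n⇒m⊓n≡m q≤c =
  ≤-trans (+-mono-≤ (m⊓n≤m a c) (m⊓n≤m b c)) ab≤pq

short-by-two : ∀ {s n} d → s + d ≡ n → d ≢ 0 → d ≢ 1 → 2 + s ≤ n
short-by-two zero          _    d≢0 _   = contradiction refl d≢0
short-by-two (suc zero)    _    _   d≢1 = contradiction refl d≢1
short-by-two {s} (suc (suc d)) refl _ _ =
  subst (2 + s ≤_) (+-comm (2 + d) s) (s≤s (s≤s (m≤n+m s d)))

n+s≤2[n∸1] : ∀ {s n} → 2 + s ≤ n → n + s ≤ (n ∸ 1) + (n ∸ 1)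
n+s≤2[n∸1] {s} {suc (suc n)} (s≤s (s≤s s≤n)) =
  s≤s (subst (suc (n + s) ≤_) (sym (+-suc n n)) (s≤s (+-monoʳ-≤ n s≤n)))

∣p++q∣≡∣p∣+∣q∣ : ∀ {k m} (p : Subset k) (q : Subset m) → ∣ p ++ q ∣ ≡ ∣ p ∣ + ∣ q ∣
∣p++q∣≡∣p∣+∣q∣ []            q = refl
∣p++q∣≡∣p∣+∣q∣ (inside  ∷ p) q = cong suc (∣p++q∣≡∣p∣+∣q∣ p q)
∣p++q∣≡∣p∣+∣q∣ (outside ∷ p) q = ∣p++q∣≡∣p∣+∣q∣ p q

∣p∪q∣+∣p∩q∣≡∣p∣+∣q∣ : ∀ {m} (p q : Subset m) → ∣ p ∪ q ∣ + ∣ p ∩ q ∣ ≡ ∣ p ∣ + ∣ q ∣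
∣p∪q∣+∣p∩q∣≡∣p∣+∣q∣ []            []            = refl
∣p∪q∣+∣p∩q∣≡∣p∣+∣q∣ (inside  ∷ p) (inside  ∷ q) =
  cong suc (trans (+-suc _ _) (trans (cong suc (∣p∪q∣+∣p∩q∣≡∣p∣+∣q∣ p q)) (sym (+-suc _ _))))
∣p∪q∣+∣p∩q∣≡∣p∣+∣q∣ (inside  ∷ p) (outside ∷ q) = cong suc (∣p∪q∣+∣p∩q∣≡∣p∣+∣q∣ p q)
∣p∪q∣+∣p∩q∣≡∣p∣+∣q∣ (outside ∷ p) (inside  ∷ q) =
  trans (cong suc (∣p∪q∣+∣p∩q∣≡∣p∣+∣q∣ p q)) (sym (+-suc _ _))
∣p∪q∣+∣p∩q∣≡∣p∣+∣q∣ (outside ∷ p) (outside ∷ q) = ∣p∪q∣+∣p∩q∣≡∣p∣+∣q∣ p q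

∣p∩q∣+∣p─q∣≡∣p∣ : ∀ {m} (p q : Subset m) → ∣ p ∩ q ∣ + ∣ p ─ q ∣ ≡ ∣ p ∣
∣p∩q∣+∣p─q∣≡∣p∣ []            []            = refl
∣p∩q∣+∣p─q∣≡∣p∣ (inside  ∷ p) (inside  ∷ q) = cong suc (∣p∩q∣+∣p─q∣≡∣p∣ p q)
∣p∩q∣+∣p─q∣≡∣p∣ (inside  ∷ p) (outside ∷ q) =
  trans (+-suc _ _) (cong suc (∣p∩q∣+∣p─q∣≡∣p∣ p q))
∣p∩q∣+∣p─q∣≡∣p∣ (outside ∷ p) (inside  ∷ q) = ∣p∩q∣+∣p─q∣≡∣p∣ p q
∣p∩q∣+∣p─q∣≡∣p∣ (outside ∷ p) (outside ∷ q) = ∣p∩q∣+∣p─q∣≡∣p∣ p q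

x∈p⇒0<∣p∣ : ∀ {m} {i : Fin m} {p : Subset m} → i ∈ p → 0 < ∣ p ∣
x∈p⇒0<∣p∣ {i = i} {p} i∈p = subst (_≤ ∣ p ∣) (∣⁅x⁆∣≡1 i) (p⊆q⇒∣p∣≤∣q∣ ⁅i⁆⊆p)
  where
  ⁅i⁆⊆p : ⁅ i ⁆ ⊆ p
  ⁅i⁆⊆p j∈⁅i⁆ = subst (_∈ p) (sym (x∈⁅y⁆⇒x≡y i j∈⁅i⁆)) i∈p

∣p∣≡0 : ∀ {m} {p : Subset m} → (∀ i → i ∉ p) → ∣ p ∣ ≡ 0
∣p∣≡0 {m} none = trans (cong ∣_∣ (Empty-unique (λ (i , i∈p) → none i i∈p))) (∣⊥∣≡0 m)

∣p∣≡m : ∀ {m} {p : Subset m} → (∀ i → i ∈ p) → ∣ p ∣ ≡ m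
∣p∣≡m {m} all = trans (cong ∣_∣ (⊆-antisym ⊆⊤ (λ {i} _ → all i))) (∣⊤∣≡n m)

x∉p⇒∣p∣<m : ∀ {m} {i : Fin m} {p : Subset m} → i ∉ p → ∣ p ∣ < m
x∉p⇒∣p∣<m {m} {i} {p} i∉p = ≤∧≢⇒< (∣p∣≤n p) ∣p∣≢m
  where
  ∣p∣≢m : ∣ p ∣ ≢ m
  ∣p∣≢m ∣p∣≡m = i∉p (subst (i ∈_) (sym (∣p∣≡n⇒p≡⊤ ∣p∣≡m)) ∈⊤)

∣p─q∣≡0⇒p⊆q : ∀ {m} (p q : Subset m) → ∣ p ─ q ∣ ≡ 0 → p ⊆ q
∣p─q∣≡0⇒p⊆q p q ∣p─q∣≡0 {i} i∈p with i ∈? q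
... | yes i∈q = i∈q
... | no  i∉q = contradiction ∣p─q∣≡0 (n>0⇒n≢0 (x∈p⇒0<∣p∣ (x∈p∧x∉q⇒x∈p─q i∈p i∉q)))

⊈⇒∣p∩q∣<∣p∣ : ∀ {m} (p q : Subset m) → ¬ p ⊆ q → ∣ p ∩ q ∣ < ∣ p ∣
⊈⇒∣p∩q∣<∣p∣ p q p⊈q = begin-strict
  ∣ p ∩ q ∣             ≡⟨ +-identityʳ _ ⟨
  ∣ p ∩ q ∣ + 0         <⟨ +-monoʳ-< ∣ p ∩ q ∣ (n≢0⇒n>0 (p⊈q ∘ ∣p─q∣≡0⇒p⊆q p q)) ⟩
  ∣ p ∩ q ∣ + ∣ p ─ q ∣ ≡⟨ ∣p∩q∣+∣p─q∣≡∣p∣ p q ⟩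
  ∣ p ∣                 ∎
  where open ≤-Reasoning

p⊆q⇒p∩q≡p : ∀ {m} {p q : Subset m} → p ⊆ q → p ∩ q ≡ p
p⊆q⇒p∩q≡p {p = p} {q} p⊆q = ⊆-antisym (p∩q⊆p p q) (λ i∈p → x∈p∩q⁺ (i∈p , p⊆q i∈p))

p⊆q⇒p∪q≡q : ∀ {m} {p q : Subset m} → p ⊆ q → p ∪ q ≡ q
p⊆q⇒p∪q≡q {p = p} {q} p⊆q = ⊆-antisym ([ p⊆q , id ] ∘ x∈p∪q⁻ p q) (q⊆p∪q p q)

∪-mono-⊆ : ∀ {m} {p p′ q q′ : Subset m} → p ⊆ p′ → q ⊆ q′ → p ∪ q ⊆ p′ ∪ q′
∪-mono-⊆ {p = p} {q = q} p⊆p′ q⊆q′ = x∈p∪q⁺ ∘ map-⊎ p⊆p′ q⊆q′ ∘ x∈p∪q⁻ p q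

∩-mono-⊆ : ∀ {m} {p p′ q q′ : Subset m} → p ⊆ p′ → q ⊆ q′ → p ∩ q ⊆ p′ ∩ q′
∩-mono-⊆ {p = p} {q = q} p⊆p′ q⊆q′ = x∈p∩q⁺ ∘ map-× p⊆p′ q⊆q′ ∘ x∈p∩q⁻ p q

∪-lub : ∀ {m} {p q r : Subset m} → p ⊆ r → q ⊆ r → p ∪ q ⊆ r
∪-lub {p = p} {q} p⊆r q⊆r = [ p⊆r , q⊆r ] ∘ x∈p∪q⁻ p q

module Connectivity {m} (M : Matroid m) where
  open Matroid M

  rank∁≤rank⊤ : ∀ X → rank (∁ X) ≤ rank ⊤
  rank∁≤rank⊤ X = rank-mono (∁ X) ⊤ ⊆⊤

  connectivity≤rank : ∀ X → connectivity M X ≤ rank X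
  connectivity≤rank X = begin
    rank X + rank (∁ X) ∸ rank ⊤  ≤⟨ ∸-monoˡ-≤ (rank ⊤) (+-monoʳ-≤ (rank X) (rank∁≤rank⊤ X)) ⟩
    rank X + rank ⊤ ∸ rank ⊤      ≡⟨ m+n∸n≡m (rank X) (rank ⊤) ⟩
    rank X                        ∎
    where open ≤-Reasoning

  connectivity≡∣X∣⇒independent : ∀ {X} → connectivity M X ≡ ∣ X ∣ → rank X ≡ ∣ X ∣
  connectivity≡∣X∣⇒independent {X} μ≡∣X∣ =
    ≤-antisym (rank-card X) (subst (_≤ rank X) μ≡∣X∣ (connectivity≤rank X))

  connectivity≡rank⇒∁spanning : ∀ {X} → connectivity M X ≡ rank X → 0 < rank X → rank (∁ X) ≡ rank ⊤
  connectivity≡rank⇒∁spanning {X} μ≡r 0<r =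
    ≤-antisym (rank∁≤rank⊤ X) (m∸n≡0⇒m≤n (cancel (rank X) (rank ⊤ ∸ rank (∁ X)) 0<r shortfall))
    where
    -- r X + r ∁X - r E  =  r X - (r E - r ∁X)
    shortfall : rank X ∸ (rank ⊤ ∸ rank (∁ X)) ≡ rank X
    shortfall = begin
      rank X ∸ (rank ⊤ ∸ rank (∁ X))                ≡⟨ cong (_∸ (rank ⊤ ∸ rank (∁ X))) (m+n∸n≡m (rank X) (rank (∁ X))) ⟨
      rank X + rank (∁ X) ∸ rank (∁ X) ∸ (rank ⊤ ∸ rank (∁ X))
                                                    ≡⟨ ∸-+-assoc (rank X + rank (∁ X)) (rank (∁ X)) _ ⟩
      rank X + rank (∁ X) ∸ (rank (∁ X) + (rank ⊤ ∸ rank (∁ X)))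
                                                    ≡⟨ cong (rank X + rank (∁ X) ∸_) (m+[n∸m]≡n (rank∁≤rank⊤ X)) ⟩
      connectivity M X                              ≡⟨ μ≡r ⟩
      rank X                                        ∎
      where open ≡-Reasoning
    cancel : ∀ a d → 0 < a → a ∸ d ≡ a → d ≡ 0
    cancel a       zero    _ _ = refl
    cancel (suc a) (suc d) _ e = contradiction (subst (_≤ a) e (m∸n≤m a d)) (<-irrefl refl)

-- Indicator of a Boolean; note  countIn n I X = 𝟙 (I X) + 𝟙 (I (∁ X)).
𝟙 : Bool → ℕ
𝟙 b = if b then 1 else 0

-- Let N be a matroid of rank n and 𝓘 a family of n-element
-- bases of N that are "free" (a set Y incomparable with B ∈ 𝓘 has rank
-- exceeding |B ∩ Y|) and pairwise not differing in a single element.  Then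
-- lowering the rank of every member of 𝓘 by one (turning them into
-- circuit-hyperplanes) gives again a matroid.
module Tightening {m} (N : Matroid m) (n : ℕ) (𝓘 : Subset m → Bool)
  (N-rank : Matroid.rank N ⊤ ≡ n)
  (𝓘-size : ∀ {B} → 𝓘 B ≡ true → ∣ B ∣ ≡ n)
  (𝓘-rank : ∀ {B} → 𝓘 B ≡ true → Matroid.rank N B ≡ n)
  (𝓘-free : ∀ {B Y} → 𝓘 B ≡ true → ¬ B ⊆ Y → ¬ Y ⊆ B → suc ∣ B ∩ Y ∣ ≤ Matroid.rank N Y)
  (𝓘-far : ∀ {B B′} → 𝓘 B ≡ true → 𝓘 B′ ≡ true → ∣ B ─ B′ ∣ ≢ 1)
  where
  open Matroid N renaming (rank to f; rank-card to f-card; rank-mono to f-mono; rank-submod to f-submod)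

  -- rk is used only through the three facts stated in this block.
  opaque
    rk : Subset m → ℕ
    rk X = f X ∸ 𝟙 (𝓘 X)

    rk≤f : ∀ X → rk X ≤ f X
    rk≤f X = m∸n≤m (f X) (𝟙 (𝓘 X))

    rk-in : ∀ {X} → 𝓘 X ≡ true → rk X ≡ n ∸ 1
    rk-in {X} X∈𝓘 rewrite X∈𝓘 = cong (_∸ 1) (𝓘-rank X∈𝓘)

    rk-out : ∀ {X} → 𝓘 X ≡ false → rk X ≡ f X
    rk-out X∉𝓘 rewrite X∉𝓘 = refl

  f≤n : ∀ X → f X ≤ n
  f≤n X = subst (f X ≤_) N-rank (f-mono X ⊤ ⊆⊤)

  rk-card : ∀ X → rk X ≤ ∣ X ∣
  rk-card X = ≤-trans (rk≤f X) (f-card X)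

  -- The only nontrivial case: X ∉ 𝓘 is then a proper subset of Y ∈ 𝓘, so |X| < n.
  rk-mono : ∀ X Y → X ⊆ Y → rk X ≤ rk Y
  rk-mono X Y X⊆Y with 𝓘 Y in Y∈? | 𝓘 X in X∈?
  ... | false | _     = ≤-trans (rk≤f X) (subst (f X ≤_) (sym (rk-out Y∈?)) (f-mono X Y X⊆Y))
  ... | true  | true  = ≤-reflexive (trans (rk-in X∈?) (sym (rk-in Y∈?)))
  ... | true  | false = begin
    rk X       ≤⟨ rk-card X ⟩
    ∣ X ∣      ≤⟨ <⇒≤pred (subst₂ _<_ (cong ∣_∣ (trans (∩-comm Y X) (p⊆q⇒p∩q≡p X⊆Y))) (𝓘-size Y∈?)
                                     (⊈⇒∣p∩q∣<∣p∣ Y X Y⊈X)) ⟩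
    n ∸ 1      ≡⟨ rk-in Y∈? ⟨
    rk Y       ∎
    where
    open ≤-Reasoning
    Y⊈X : ¬ Y ⊆ X
    Y⊈X Y⊆X with () ← trans (sym X∈?) (trans (cong 𝓘 (⊆-antisym X⊆Y Y⊆X)) Y∈?)

  SubmodularAt : Subset m → Subset m → Set
  SubmodularAt X Y = rk (X ∪ Y) + rk (X ∩ Y) ≤ rk X + rk Y

  submodular-sym : ∀ {X Y} → SubmodularAt Y X → SubmodularAt X Y
  submodular-sym {X} {Y} = subst₂ _≤_ (cong₂ _+_ (cong rk (∪-comm Y X)) (cong rk (∩-comm Y X)))
                                      (+-comm (rk Y) (rk X))

  submodular-⊆ : ∀ {X Y} → X ⊆ Y → SubmodularAt X Y
  submodular-⊆ {X} {Y} X⊆Y rewrite p⊆q⇒p∪q≡q X⊆Y | p⊆q⇒p∩q≡p X⊆Y = ≤-reflexive (+-comm (rk Y) (rk X))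

  -- X ∈ 𝓘, Y ∉ 𝓘 incomparable: freeness of X pays for the lost unit.
  submodular-one : ∀ {X Y} → 𝓘 X ≡ true → 𝓘 Y ≡ false → ¬ X ⊆ Y → ¬ Y ⊆ X → SubmodularAt X Y
  submodular-one {X} {Y} X∈𝓘 Y∉𝓘 X⊈Y Y⊈X = begin
    rk (X ∪ Y) + rk (X ∩ Y)   ≤⟨ +-mono-≤ (≤-trans (rk≤f (X ∪ Y)) (f≤n (X ∪ Y))) (rk-card (X ∩ Y)) ⟩
    n + s                     ≡⟨ shift (subst (s <_) (𝓘-size X∈𝓘) (⊈⇒∣p∩q∣<∣p∣ X Y X⊈Y)) ⟩
    (n ∸ 1) + suc s           ≤⟨ +-monoʳ-≤ (n ∸ 1) (𝓘-free X∈𝓘 X⊈Y Y⊈X) ⟩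
    (n ∸ 1) + f Y             ≡⟨ cong₂ _+_ (rk-in X∈𝓘) (rk-out Y∉𝓘) ⟨
    rk X + rk Y               ∎
    where
    open ≤-Reasoning
    s = ∣ X ∩ Y ∣
    shift : ∀ {a b} → a < b → b + a ≡ (b ∸ 1) + suc a
    shift {a} {suc b} _ = sym (+-suc b a)

  -- X, Y ∈ 𝓘 incomparable: they differ in at least two elements.
  submodular-two : ∀ {X Y} → 𝓘 X ≡ true → 𝓘 Y ≡ true → ¬ X ⊆ Y → SubmodularAt X Y
  submodular-two {X} {Y} X∈𝓘 Y∈𝓘 X⊈Y = begin
    rk (X ∪ Y) + rk (X ∩ Y)   ≤⟨ +-mono-≤ (≤-trans (rk≤f (X ∪ Y)) (f≤n (X ∪ Y))) (rk-card (X ∩ Y)) ⟩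
    n + ∣ X ∩ Y ∣             ≤⟨ n+s≤2[n∸1] (short-by-two ∣ X ─ Y ∣
                                   (trans (∣p∩q∣+∣p─q∣≡∣p∣ X Y) (𝓘-size X∈𝓘))
                                   (X⊈Y ∘ ∣p─q∣≡0⇒p⊆q X Y) (𝓘-far X∈𝓘 Y∈𝓘)) ⟩
    (n ∸ 1) + (n ∸ 1)         ≡⟨ cong₂ _+_ (rk-in X∈𝓘) (rk-in Y∈𝓘) ⟨
    rk X + rk Y               ∎
    where open ≤-Reasoning

  rk-submod : ∀ X Y → SubmodularAt X Y
  rk-submod X Y with X ⊆? Y | Y ⊆? X
  ... | yes X⊆Y | _       = submodular-⊆ X⊆Y
  ... | no  _   | yes Y⊆X = submodular-sym (submodular-⊆ Y⊆X)
  ... | no  X⊈Y | no  Y⊈X with 𝓘 X in X∈? | 𝓘 Y in Y∈?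
  ...   | true  | true  = submodular-two X∈? Y∈? X⊈Y
  ...   | true  | false = submodular-one X∈? Y∈? X⊈Y Y⊈X
  ...   | false | true  = submodular-sym (submodular-one Y∈? X∈? Y⊈X X⊈Y)
  ...   | false | false = begin
    rk (X ∪ Y) + rk (X ∩ Y)   ≤⟨ +-mono-≤ (rk≤f (X ∪ Y)) (rk≤f (X ∩ Y)) ⟩
    f (X ∪ Y) + f (X ∩ Y)     ≤⟨ f-submod X Y ⟩
    f X + f Y                 ≡⟨ cong₂ _+_ (rk-out X∈?) (rk-out Y∈?) ⟨
    rk X + rk Y               ∎
    where open ≤-Reasoning

  tightened : Matroid m
  tightened = record { rank = rk ; rank-card = rk-card ; rank-mono = rk-mono ; rank-submod = rk-submod }

module Legs (n : ℕ) where
  open BooleanAlgebra (∪-∩-booleanAlgebra n) using (∧-distribʳ-∨)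
  open import Algebra.Lattice.Properties.BooleanAlgebra (∪-∩-booleanAlgebra n)
    using (deMorgan₁; deMorgan₂)

  xs ys : Sub n → Subset n
  xs = take n
  ys = drop n

  halves : ∀ X → xs X ++ ys X ≡ X
  halves = take++drop≡id n

  xs-++ : ∀ a b → xs (a ++ b) ≡ a
  xs-++ a b = ++-injectiveˡ (xs (a ++ b)) a (halves (a ++ b))

  ys-++ : ∀ a b → ys (a ++ b) ≡ b
  ys-++ a b = ++-injectiveʳ (xs (a ++ b)) a (halves (a ++ b))

  lookup-x : ∀ X i → lookup X (x n i) ≡ lookup (xs X) i
  lookup-x X i = trans (cong (λ Z → lookup Z (x n i)) (sym (halves X))) (lookup-++ˡ (xs X) (ys X) i)

  lookup-y : ∀ X i → lookup X (y n i) ≡ lookup (ys X) i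
  lookup-y X i = trans (cong (λ Z → lookup Z (y n i)) (sym (halves X))) (lookup-++ʳ (xs X) (ys X) i)

  ∈xs⁺ : ∀ {X i} → x n i ∈ X → i ∈ xs X
  ∈xs⁺ {X} {i} x∈X = lookup⇒[]= i (xs X) (trans (sym (lookup-x X i)) ([]=⇒lookup x∈X))

  ∈xs⁻ : ∀ {X i} → i ∈ xs X → x n i ∈ X
  ∈xs⁻ {X} {i} i∈xs = lookup⇒[]= (x n i) X (trans (lookup-x X i) ([]=⇒lookup i∈xs))

  ∈ys⁺ : ∀ {X i} → y n i ∈ X → i ∈ ys X
  ∈ys⁺ {X} {i} y∈X = lookup⇒[]= i (ys X) (trans (sym (lookup-y X i)) ([]=⇒lookup y∈X))

  ∈ys⁻ : ∀ {X i} → i ∈ ys X → y n i ∈ X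
  ∈ys⁻ {X} {i} i∈ys = lookup⇒[]= (y n i) X (trans (lookup-y X i) ([]=⇒lookup i∈ys))

  xs-∪ : ∀ X Y → xs (X ∪ Y) ≡ xs X ∪ xs Y
  xs-∪ = take-zipWith _∨_
  ys-∪ : ∀ X Y → ys (X ∪ Y) ≡ ys X ∪ ys Y
  ys-∪ = drop-zipWith _∨_
  xs-∩ : ∀ X Y → xs (X ∩ Y) ≡ xs X ∩ xs Y
  xs-∩ = take-zipWith _∧_
  ys-∩ : ∀ X Y → ys (X ∩ Y) ≡ ys X ∩ ys Y
  ys-∩ = drop-zipWith _∧_
  xs-∁ : ∀ X → xs (∁ X) ≡ ∁ (xs X)
  xs-∁ = take-map not n
  ys-∁ : ∀ X → ys (∁ X) ≡ ∁ (ys X)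
  ys-∁ = drop-map not n

  xs-mono : ∀ {X Y} → X ⊆ Y → xs X ⊆ xs Y
  xs-mono X⊆Y = ∈xs⁺ ∘ X⊆Y ∘ ∈xs⁻
  ys-mono : ∀ {X Y} → X ⊆ Y → ys X ⊆ ys Y
  ys-mono X⊆Y = ∈ys⁺ ∘ X⊆Y ∘ ∈ys⁻

  legsMet legsIn : Sub n → Subset n
  legsMet X = xs X ∪ ys X
  legsIn  X = xs X ∩ ys X

  k : Sub n → ℕ
  k X = ∣ legsIn X ∣

  l≡∣legsMet∣ : ∀ X → l n X ≡ ∣ legsMet X ∣
  l≡∣legsMet∣ X = cong ∣_∣ (trans (tabulate-cong pointwise) (tabulate∘lookup (legsMet X)))
    where
    pointwise : ∀ i → lookup X (x n i) ∨ lookup X (y n i) ≡ lookup (legsMet X) i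
    pointwise i = trans (cong₂ _∨_ (lookup-x X i) (lookup-y X i))
                        (sym (lookup-zipWith _∨_ i (xs X) (ys X)))

  -- |X| = l(X) + k(X): a met leg contributes one element, an included leg two.
  ∣X∣≡l+k : ∀ X → ∣ X ∣ ≡ l n X + k X
  ∣X∣≡l+k X = begin
    ∣ X ∣                           ≡⟨ cong ∣_∣ (halves X) ⟨
    ∣ xs X ++ ys X ∣                ≡⟨ ∣p++q∣≡∣p∣+∣q∣ (xs X) (ys X) ⟩
    ∣ xs X ∣ + ∣ ys X ∣             ≡⟨ ∣p∪q∣+∣p∩q∣≡∣p∣+∣q∣ (xs X) (ys X) ⟨
    ∣ legsMet X ∣ + k X             ≡⟨ cong (_+ k X) (l≡∣legsMet∣ X) ⟨
    l n X + k X                     ∎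
    where open ≡-Reasoning

  l∁≡n∸k : ∀ X → l n (∁ X) ≡ n ∸ k X
  l∁≡n∸k X = begin
    l n (∁ X)                   ≡⟨ l≡∣legsMet∣ (∁ X) ⟩
    ∣ xs (∁ X) ∪ ys (∁ X) ∣     ≡⟨ cong ∣_∣ (cong₂ _∪_ (xs-∁ X) (ys-∁ X)) ⟩
    ∣ ∁ (xs X) ∪ ∁ (ys X) ∣     ≡⟨ cong ∣_∣ (deMorgan₁ (xs X) (ys X)) ⟨
    ∣ ∁ (legsIn X) ∣            ≡⟨ ∣∁p∣≡n∸∣p∣ (legsIn X) ⟩
    n ∸ k X                     ∎
    where open ≡-Reasoning

  k∁≡n∸l : ∀ X → k (∁ X) ≡ n ∸ l n X
  k∁≡n∸l X = begin
    k (∁ X)                     ≡⟨ cong ∣_∣ (cong₂ _∩_ (xs-∁ X) (ys-∁ X)) ⟩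
    ∣ ∁ (xs X) ∩ ∁ (ys X) ∣     ≡⟨ cong ∣_∣ (deMorgan₂ (xs X) (ys X)) ⟨
    ∣ ∁ (legsMet X) ∣           ≡⟨ ∣∁p∣≡n∸∣p∣ (legsMet X) ⟩
    n ∸ ∣ legsMet X ∣           ≡⟨ cong (n ∸_) (l≡∣legsMet∣ X) ⟨
    n ∸ l n X                   ∎
    where open ≡-Reasoning

  l≤n : ∀ X → l n X ≤ n
  l≤n X = subst (_≤ n) (sym (l≡∣legsMet∣ X)) (∣p∣≤n (legsMet X))

  l-mono : ∀ {X Y} → X ⊆ Y → l n X ≤ l n Y
  l-mono {X} {Y} X⊆Y = subst₂ _≤_ (sym (l≡∣legsMet∣ X)) (sym (l≡∣legsMet∣ Y))
    (p⊆q⇒∣p∣≤∣q∣ (∪-mono-⊆ (xs-mono X⊆Y) (ys-mono X⊆Y)))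

  k-mono : ∀ {X Y} → X ⊆ Y → k X ≤ k Y
  k-mono X⊆Y = p⊆q⇒∣p∣≤∣q∣ (∩-mono-⊆ (xs-mono X⊆Y) (ys-mono X⊆Y))

  -- l is submodular: the legs met by X ∪ Y and X ∩ Y are bounded by those of X and Y.
  l-submodular : ∀ X Y → l n (X ∪ Y) + l n (X ∩ Y) ≤ l n X + l n Y
  l-submodular X Y = begin
    l n (X ∪ Y) + l n (X ∩ Y)             ≡⟨ cong₂ _+_ (l≡∣legsMet∣ (X ∪ Y)) (l≡∣legsMet∣ (X ∩ Y)) ⟩
    ∣ legsMet (X ∪ Y) ∣ + ∣ legsMet (X ∩ Y) ∣
      ≤⟨ +-mono-≤ (p⊆q⇒∣p∣≤∣q∣ met∪) (p⊆q⇒∣p∣≤∣q∣ met∩) ⟩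
    ∣ A ∪ B ∣ + ∣ A ∩ B ∣                 ≡⟨ ∣p∪q∣+∣p∩q∣≡∣p∣+∣q∣ A B ⟩
    ∣ A ∣ + ∣ B ∣                         ≡⟨ cong₂ _+_ (l≡∣legsMet∣ X) (l≡∣legsMet∣ Y) ⟨
    l n X + l n Y                         ∎
    where
    open ≤-Reasoning
    A = legsMet X
    B = legsMet Y
    met∪ : legsMet (X ∪ Y) ⊆ A ∪ B
    met∪ rewrite xs-∪ X Y | ys-∪ X Y =
      ∪-lub (∪-mono-⊆ (p⊆p∪q (ys X)) (p⊆p∪q (ys Y))) (∪-mono-⊆ (q⊆p∪q (xs X) _) (q⊆p∪q (xs Y) _))
    met∩ : legsMet (X ∩ Y) ⊆ A ∩ B
    met∩ rewrite xs-∩ X Y | ys-∩ X Y =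
      ∪-lub (∩-mono-⊆ (p⊆p∪q (ys X)) (p⊆p∪q (ys Y))) (∩-mono-⊆ (q⊆p∪q (xs X) _) (q⊆p∪q (xs Y) _))

  transversal⇒k≡0 : ∀ {X} → Transversal n X → k X ≡ 0
  transversal⇒k≡0 {X} t = ∣p∣≡0 notIncluded
    where
    notIncluded : ∀ i → i ∉ legsIn X
    notIncluded i i∈ with t i | x∈p∩q⁻ (xs X) (ys X) i∈
    ... | inj₁ (_ , y∉X) | _ , i∈ys = y∉X (∈ys⁻ i∈ys)
    ... | inj₂ (x∉X , _) | i∈xs , _ = x∉X (∈xs⁻ i∈xs)

  transversal⇒l≡n : ∀ {X} → Transversal n X → l n X ≡ n
  transversal⇒l≡n {X} t = trans (l≡∣legsMet∣ X) (∣p∣≡m met)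
    where
    met : ∀ i → i ∈ legsMet X
    met i with t i
    ... | inj₁ (x∈X , _) = x∈p∪q⁺ (inj₁ (∈xs⁺ x∈X))
    ... | inj₂ (_ , y∈X) = x∈p∪q⁺ (inj₂ (∈ys⁺ y∈X))

  k≡0∧l≡n⇒transversal : ∀ {X} → k X ≡ 0 → l n X ≡ n → Transversal n X
  k≡0∧l≡n⇒transversal {X} k≡0 l≡n i =
    map-⊎ (λ i∈xs → ∈xs⁻ i∈xs , λ y∈X → notBoth (i∈xs , ∈ys⁺ y∈X))
          (λ i∈ys → (λ x∈X → notBoth (∈xs⁺ x∈X , i∈ys)) , ∈ys⁻ i∈ys)
          (x∈p∪q⁻ (xs X) (ys X) met)
    where
    met : i ∈ legsMet X
    met = subst (i ∈_) (sym (∣p∣≡n⇒p≡⊤ (trans (sym (l≡∣legsMet∣ X)) l≡n))) ∈⊤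
    notBoth : ¬ (i ∈ xs X × i ∈ ys X)
    notBoth both = <-irrefl (sym k≡0) (x∈p⇒0<∣p∣ (x∈p∩q⁺ both))

  ∣transversal∣≡n : ∀ {X} → Transversal n X → ∣ X ∣ ≡ n
  ∣transversal∣≡n {X} t =
    trans (∣X∣≡l+k X) (trans (cong₂ _+_ (transversal⇒l≡n t) (transversal⇒k≡0 t)) (+-identityʳ n))

  transversal-∁ : ∀ {X} → Transversal n X → Transversal n (∁ X)
  transversal-∁ t i with t i
  ... | inj₁ (x∈X , y∉X) = inj₂ (x∈p⇒x∉∁p x∈X , x∉p⇒x∈∁p y∉X)
  ... | inj₂ (x∉X , y∈X) = inj₁ (x∉p⇒x∈∁p x∉X , x∈p⇒x∉∁p y∈X)

  transversal-∁⁻ : ∀ {X} → Transversal n (∁ X) → Transversal n X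
  transversal-∁⁻ t i with t i
  ... | inj₁ (x∈∁X , y∉∁X) = inj₂ (x∈∁p⇒x∉p x∈∁X , x∉∁p⇒x∈p y∉∁X)
  ... | inj₂ (x∉∁X , y∈∁X) = inj₁ (x∉∁p⇒x∈p x∉∁X , x∈∁p⇒x∉p y∈∁X)

  transversal? : ∀ X → Dec (Transversal n X)
  transversal? X = all? λ i → (x n i ∈? X ×-dec ¬? (y n i ∈? X)) ⊎-dec (¬? (x n i ∈? X) ×-dec y n i ∈? X)

  ⊤-not-transversal : 0 < n → ¬ Transversal n ⊤
  ⊤-not-transversal 0<n t with t (fromℕ< 0<n)
  ... | inj₁ (_ , y∉⊤) = y∉⊤ ∈⊤
  ... | inj₂ (x∉⊤ , _) = x∉⊤ ∈⊤

  included⇒0<k : ∀ {X i} → Includes n X i → 0 < k X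
  included⇒0<k (x∈X , y∈X) = x∈p⇒0<∣p∣ (x∈p∩q⁺ (∈xs⁺ x∈X , ∈ys⁺ y∈X))

  noneIncluded⇒k≡0 : ∀ {X} → ¬ (∃ λ i → Includes n X i) → k X ≡ 0
  noneIncluded⇒k≡0 {X} none = ∣p∣≡0 λ i i∈ →
    let i∈xs , i∈ys = x∈p∩q⁻ (xs X) (ys X) i∈ in none (i , ∈xs⁻ i∈xs , ∈ys⁻ i∈ys)

  disjoint⇒l<n : ∀ {X i} → DisjointFrom n X i → l n X < n
  disjoint⇒l<n {X} (x∉X , y∉X) = subst (_< n) (sym (l≡∣legsMet∣ X))
    (x∉p⇒∣p∣<m ([ x∉X ∘ ∈xs⁻ , y∉X ∘ ∈ys⁻ ] ∘ x∈p∪q⁻ (xs X) (ys X)))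

  noneDisjoint⇒l≡n : ∀ {X} → ¬ (∃ λ i → DisjointFrom n X i) → l n X ≡ n
  noneDisjoint⇒l≡n {X} none = trans (l≡∣legsMet∣ X) (∣p∣≡m met)
    where
    met : ∀ i → i ∈ legsMet X
    met i with i ∈? legsMet X
    ... | yes i∈ = i∈
    ... | no  i∉ = contradiction (i , i∉ ∘ x∈p∪q⁺ ∘ inj₁ ∘ ∈xs⁺ , i∉ ∘ x∈p∪q⁺ ∘ inj₂ ∘ ∈ys⁺) none

  k≡0-⊆transversal : ∀ {Z B} → Transversal n B → Z ⊆ B → k Z ≡ 0
  k≡0-⊆transversal t Z⊆B = n≤0⇒n≡0 (subst (_ ≤_) (transversal⇒k≡0 t) (k-mono Z⊆B))

  k≡0⇒l≡∣X∣ : ∀ {X} → k X ≡ 0 → l n X ≡ ∣ X ∣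
  k≡0⇒l≡∣X∣ {X} k≡0 = sym (trans (∣X∣≡l+k X) (trans (cong (l n X +_) k≡0) (+-identityʳ _)))

  withoutLeg : Fin n → Sub n
  withoutLeg i = ∁ ⁅ i ⁆ ++ ∁ ⁅ i ⁆

  l[transversal−leg] : ∀ {X} i → Transversal n X → l n (X ∩ withoutLeg i) ≡ n ∸ 1
  l[transversal−leg] {X} i t = begin
    l n (X ∩ withoutLeg i)                          ≡⟨ l≡∣legsMet∣ (X ∩ withoutLeg i) ⟩
    ∣ xs (X ∩ withoutLeg i) ∪ ys (X ∩ withoutLeg i) ∣
      ≡⟨ cong ∣_∣ (cong₂ _∪_ (trans (xs-∩ X _) (cong (xs X ∩_) (xs-++ _ _)))
                             (trans (ys-∩ X _) (cong (ys X ∩_) (ys-++ _ _)))) ⟩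
    ∣ (xs X ∩ ∁ ⁅ i ⁆) ∪ (ys X ∩ ∁ ⁅ i ⁆) ∣         ≡⟨ cong ∣_∣ (∧-distribʳ-∨ (∁ ⁅ i ⁆) (xs X) (ys X)) ⟨
    ∣ legsMet X ∩ ∁ ⁅ i ⁆ ∣                         ≡⟨ cong (λ p → ∣ p ∩ ∁ ⁅ i ⁆ ∣) legsMet≡⊤ ⟩
    ∣ ⊤ ∩ ∁ ⁅ i ⁆ ∣                                 ≡⟨ cong ∣_∣ (∩-identityˡ (∁ ⁅ i ⁆)) ⟩
    ∣ ∁ ⁅ i ⁆ ∣                                     ≡⟨ ∣∁p∣≡n∸∣p∣ ⁅ i ⁆ ⟩
    n ∸ ∣ ⁅ i ⁆ ∣                                   ≡⟨ cong (n ∸_) (∣⁅x⁆∣≡1 i) ⟩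
    n ∸ 1                                           ∎
    where
    open ≡-Reasoning
    legsMet≡⊤ : legsMet X ≡ ⊤
    legsMet≡⊤ = ∣p∣≡n⇒p≡⊤ (trans (sym (l≡∣legsMet∣ X)) (transversal⇒l≡n t))

  ∣∩∣-adjacent : ∀ {X Y} → Adjacent n X Y → ∣ X ∩ Y ∣ + 1 ≡ n
  ∣∩∣-adjacent {X} {Y} (tX , _ , ∣X─Y∣≡1) =
    trans (cong (∣ X ∩ Y ∣ +_) (sym ∣X─Y∣≡1)) (trans (∣p∩q∣+∣p─q∣≡∣p∣ X Y) (∣transversal∣≡n tX))

  ∣∪∣-adjacent : ∀ {X Y} → Adjacent n X Y → ∣ X ∪ Y ∣ ≡ 1 + n
  ∣∪∣-adjacent {X} {Y} adj@(tX , tY , _) = +-cancelʳ-≡ ∣ X ∩ Y ∣ ∣ X ∪ Y ∣ (1 + n) (begin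
    ∣ X ∪ Y ∣ + ∣ X ∩ Y ∣       ≡⟨ ∣p∪q∣+∣p∩q∣≡∣p∣+∣q∣ X Y ⟩
    ∣ X ∣ + ∣ Y ∣               ≡⟨ cong₂ _+_ (∣transversal∣≡n tX) (∣transversal∣≡n tY) ⟩
    n + n                       ≡⟨ cong (n +_) (∣∩∣-adjacent adj) ⟨
    n + (∣ X ∩ Y ∣ + 1)         ≡⟨ cong (n +_) (+-comm ∣ X ∩ Y ∣ 1) ⟩
    n + suc ∣ X ∩ Y ∣           ≡⟨ +-suc n ∣ X ∩ Y ∣ ⟩
    1 + n + ∣ X ∩ Y ∣           ∎)
    where open ≡-Reasoning

-- The arithmetic core of the submodularity of  l + min(1, k)  (values at
-- U = X ∪ Y, N = X ∩ Y, X, Y): l is submodular, l + k is modular, and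
-- k(N) is at most k(X) and k(Y).  Unless N includes a leg, at most one
-- unit is gained on the left; if no set involved includes a leg, the
-- modularity of l + k is what is needed.
spike-arith : ∀ lU lN lX lY kU kN kX kY → lU + lN ≤ lX + lY →
  (lU + kU) + (lN + kN) ≡ (lX + kX) + (lY + kY) → kN ≤ kX → kN ≤ kY →
  (lU + lN) + (1 ⊓ kU + 1 ⊓ kN) ≤ (lX + lY) + (1 ⊓ kX + 1 ⊓ kY)
spike-arith _ _ _ _ kU (suc _) (suc _) (suc _) l-sub _ _ _ = +-mono-≤ l-sub (+-monoˡ-≤ 1 (m⊓n≤m 1 kU))
spike-arith _ _ _ _ kU zero    (suc _) kY      l-sub _ _ _ =
  +-mono-≤ l-sub (≤-trans (≤-reflexive (+-identityʳ (1 ⊓ kU))) (≤-trans (m⊓n≤m 1 kU) (m≤m+n 1 (1 ⊓ kY))))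
spike-arith _ _ _ _ kU zero    zero    (suc _) l-sub _ _ _ =
  +-mono-≤ l-sub (≤-trans (≤-reflexive (+-identityʳ (1 ⊓ kU))) (m⊓n≤m 1 kU))
spike-arith lU lN lX lY kU zero    zero    zero    _ modular _ _ = begin
  (lU + lN) + (1 ⊓ kU + 0)  ≡⟨ interchange lU lN (1 ⊓ kU) 0 ⟩
  (lU + 1 ⊓ kU) + (lN + 0)  ≤⟨ +-monoˡ-≤ (lN + 0) (+-monoʳ-≤ lU (m⊓n≤n 1 kU)) ⟩
  (lU + kU) + (lN + 0)      ≡⟨ modular ⟩
  (lX + 0) + (lY + 0)       ≡⟨ interchange lX 0 lY 0 ⟩
  (lX + lY) + (0 + 0)       ∎
  where open ≤-Reasoning
spike-arith _ _ _ _ _ (suc _) zero    _       _ _ () _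
spike-arith _ _ _ _ _ (suc _) (suc _) zero    _ _ _  ()

module Spike (n : ℕ) where
  open Legs n

  h g : Sub n → ℕ
  h X = l n X + 1 ⊓ k X
  g X = h X ⊓ n

  h≤∣X∣ : ∀ X → h X ≤ ∣ X ∣
  h≤∣X∣ X = subst (h X ≤_) (sym (∣X∣≡l+k X)) (+-monoʳ-≤ (l n X) (m⊓n≤n 1 (k X)))

  h-mono : ∀ {X Y} → X ⊆ Y → h X ≤ h Y
  h-mono X⊆Y = +-mono-≤ (l-mono X⊆Y) (⊓-monoʳ-≤ 1 (k-mono X⊆Y))

  h-submodular : ∀ X Y → h (X ∪ Y) + h (X ∩ Y) ≤ h X + h Y
  h-submodular X Y = begin
    h (X ∪ Y) + h (X ∩ Y)
      ≡⟨ interchange (l n (X ∪ Y)) (1 ⊓ k (X ∪ Y)) (l n (X ∩ Y)) (1 ⊓ k (X ∩ Y)) ⟩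
    (l n (X ∪ Y) + l n (X ∩ Y)) + (1 ⊓ k (X ∪ Y) + 1 ⊓ k (X ∩ Y))
      ≤⟨ spike-arith (l n (X ∪ Y)) (l n (X ∩ Y)) (l n X) (l n Y) (k (X ∪ Y)) (k (X ∩ Y)) (k X) (k Y)
                     (l-submodular X Y) modular (k-mono (p∩q⊆p X Y)) (k-mono (p∩q⊆q X Y)) ⟩
    (l n X + l n Y) + (1 ⊓ k X + 1 ⊓ k Y)
      ≡⟨ interchange (l n X) (l n Y) (1 ⊓ k X) (1 ⊓ k Y) ⟩
    h X + h Y                                                ∎
    where
    open ≤-Reasoning
    modular : (l n (X ∪ Y) + k (X ∪ Y)) + (l n (X ∩ Y) + k (X ∩ Y)) ≡ (l n X + k X) + (l n Y + k Y)
    modular = begin-equality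
      (l n (X ∪ Y) + k (X ∪ Y)) + (l n (X ∩ Y) + k (X ∩ Y)) ≡⟨ cong₂ _+_ (∣X∣≡l+k (X ∪ Y)) (∣X∣≡l+k (X ∩ Y)) ⟨
      ∣ X ∪ Y ∣ + ∣ X ∩ Y ∣                                 ≡⟨ ∣p∪q∣+∣p∩q∣≡∣p∣+∣q∣ X Y ⟩
      ∣ X ∣ + ∣ Y ∣                                         ≡⟨ cong₂ _+_ (∣X∣≡l+k X) (∣X∣≡l+k Y) ⟩
      (l n X + k X) + (l n Y + k Y)                         ∎

  g≤∣X∣ : ∀ X → g X ≤ ∣ X ∣
  g≤∣X∣ X = ≤-trans (m⊓n≤m (h X) n) (h≤∣X∣ X)

  g-mono : ∀ X Y → X ⊆ Y → g X ≤ g Y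
  g-mono X Y X⊆Y = ⊓-monoˡ-≤ n (h-mono X⊆Y)

  g-submodular : ∀ X Y → g (X ∪ Y) + g (X ∩ Y) ≤ g X + g Y
  g-submodular X Y = ⊓-submodular n (h-submodular X Y) (h-mono (p∩q⊆p X Y)) (h-mono (p∩q⊆q X Y))

  spike : Matroid (n + n)
  spike = record { rank = g ; rank-card = g≤∣X∣ ; rank-mono = g-mono ; rank-submod = g-submodular }

  g-noLeg : ∀ {X} → k X ≡ 0 → l n X < n → g X ≡ ∣ X ∣
  g-noLeg {X} k≡0 l<n = begin
    (l n X + 1 ⊓ k X) ⊓ n   ≡⟨ cong (λ c → (l n X + 1 ⊓ c) ⊓ n) k≡0 ⟩
    (l n X + 0) ⊓ n         ≡⟨ m≤n⇒m⊓n≡m (subst (_≤ n) (sym (+-identityʳ (l n X))) (<⇒≤ l<n)) ⟩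
    l n X + 0               ≡⟨ cong (l n X +_) k≡0 ⟨
    l n X + k X             ≡⟨ ∣X∣≡l+k X ⟨
    ∣ X ∣                   ∎
    where open ≡-Reasoning

  g-someLeg : ∀ {X} → 0 < k X → l n X < n → g X ≡ l n X + 1
  g-someLeg {X} 0<k l<n = begin
    (l n X + 1 ⊓ k X) ⊓ n   ≡⟨ cong (λ c → (l n X + c) ⊓ n) (m≤n⇒m⊓n≡m 0<k) ⟩
    (l n X + 1) ⊓ n         ≡⟨ m≤n⇒m⊓n≡m (subst (_≤ n) (+-comm 1 (l n X)) l<n) ⟩
    l n X + 1               ∎
    where open ≡-Reasoning

  l≡n⇒g≡n : ∀ {X} → l n X ≡ n → g X ≡ n
  l≡n⇒g≡n {X} l≡n = m≥n⇒m⊓n≡n (subst (λ c → n ≤ c + 1 ⊓ k X) (sym l≡n) (m≤m+n n _))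

  g-transversal : ∀ {X} → Transversal n X → g X ≡ n
  g-transversal = l≡n⇒g≡n ∘ transversal⇒l≡n

  g⊤≡n : g ⊤ ≡ n
  g⊤≡n = l≡n⇒g≡n (trans (l≡∣legsMet∣ ⊤) (∣p∣≡m λ i → x∈p∪q⁺ (inj₁ (∈xs⁺ ∈⊤))))

  r≡g : ∀ X → ¬ Transversal n X → r n X ≡ g X
  r≡g X ¬t with any? (includes? n X) | any? (disjointFrom? n X)
  ... | no  none       | yes (_ , disj) = sym (g-noLeg (noneIncluded⇒k≡0 none) (disjoint⇒l<n disj))
  ... | yes (_ , incl) | yes (_ , disj) = sym (g-someLeg (included⇒0<k incl) (disjoint⇒l<n disj))
  ... | yes _          | no  none       = sym (l≡n⇒g≡n (noneDisjoint⇒l≡n none))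
  ... | no  none       | no  none′      =
    contradiction (k≡0∧l≡n⇒transversal (noneIncluded⇒k≡0 none) (noneDisjoint⇒l≡n none′)) ¬t

  λn≡ : ∀ X → ¬ Transversal n X → λn n X ≡ g X + g (∁ X) ∸ n
  λn≡ X ¬t = cong₂ (λ a b → a + b ∸ n) (r≡g X ¬t) (r≡g (∁ X) (¬t ∘ transversal-∁⁻))

  h-above : ∀ {s} Y → s ≤ l n Y → s < ∣ Y ∣ → s < h Y
  h-above {s} Y s≤l s<∣Y∣ with k Y in kY≡
  ... | zero  = subst (s <_) (trans (∣X∣≡l+k Y) (cong (l n Y +_) kY≡)) s<∣Y∣
  ... | suc _ = subst (s <_) (+-comm 1 (l n Y)) (s≤s s≤l)

  transversal-free : ∀ {B Y} → Transversal n B → ¬ B ⊆ Y → ¬ Y ⊆ B → suc ∣ B ∩ Y ∣ ≤ g Y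
  transversal-free {B} {Y} t B⊈Y Y⊈B = ⊓-glb (h-above Y s≤l s<∣Y∣) s<n
    where
    s = ∣ B ∩ Y ∣
    s≤l : s ≤ l n Y
    s≤l = subst (_≤ l n Y) (k≡0⇒l≡∣X∣ (k≡0-⊆transversal t (p∩q⊆p B Y))) (l-mono (p∩q⊆q B Y))
    s<∣Y∣ : s < ∣ Y ∣
    s<∣Y∣ = subst (_< ∣ Y ∣) (cong ∣_∣ (∩-comm Y B)) (⊈⇒∣p∩q∣<∣p∣ Y B Y⊈B)
    s<n : s < n
    s<n = subst (s <_) (∣transversal∣≡n t) (⊈⇒∣p∩q∣<∣p∣ B Y B⊈Y)

∸-indicators : ∀ n a b → (n ∸ 𝟙 a) + (n ∸ 𝟙 b) ∸ n ≡ n ∸ (𝟙 a + 𝟙 b)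
∸-indicators n             false false = m+n∸n≡m n n
∸-indicators n             true  false = m+n∸n≡m (n ∸ 1) n
∸-indicators n             false true  = m+n∸m≡n n (n ∸ 1)
∸-indicators zero          true  true  = refl
∸-indicators (suc zero)    true  true  = refl
∸-indicators (suc (suc n)) true  true  = m+n∸n≡m n (suc n)

module Sufficiency (n : ℕ) (0<n : 0 < n) (I : Sub n → Bool) (I-independent : IsIndependent n I) where
  open Legs n
  open Spike n

  I⇒transversal : ∀ {X} → I X ≡ true → Transversal n X
  I⇒transversal {X} = proj₁ I-independent X

  module Tightened = Tightening spike n I g⊤≡n
    (∣transversal∣≡n ∘ I⇒transversal)
    (g-transversal ∘ I⇒transversal)
    (transversal-free ∘ I⇒transversal)
    (λ {B} {B′} B∈I B′∈I ∣B─B′∣≡1 →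
       proj₂ I-independent B B′ B∈I B′∈I (I⇒transversal B∈I , I⇒transversal B′∈I , ∣B─B′∣≡1))
  open Tightened using (tightened; rk; rk-in; rk-out)

  non-transversal∉I : ∀ {X} → ¬ Transversal n X → I X ≡ false
  non-transversal∉I {X} ¬t with I X in X∈?
  ... | true  = contradiction (I⇒transversal X∈?) ¬t
  ... | false = refl

  rk⊤≡n : rk ⊤ ≡ n
  rk⊤≡n = trans (rk-out (non-transversal∉I (⊤-not-transversal 0<n))) g⊤≡n

  rk-transversal : ∀ {X} → Transversal n X → rk X ≡ n ∸ 𝟙 (I X)
  rk-transversal {X} t with I X in X∈?
  ... | true  = rk-in X∈?
  ... | false = trans (rk-out X∈?) (g-transversal t)

  connectivity-tightened : ∀ λ′ → Spiky n λ′ →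
    (∀ X → Transversal n X → λ′ X ≡ n ∸ countIn n I X) → ∀ X → λ′ X ≡ connectivity tightened X
  connectivity-tightened λ′ spiky on-T X with transversal? X
  ... | yes t = begin
    λ′ X                                      ≡⟨ on-T X t ⟩
    n ∸ (𝟙 (I X) + 𝟙 (I (∁ X)))               ≡⟨ ∸-indicators n (I X) (I (∁ X)) ⟨
    (n ∸ 𝟙 (I X)) + (n ∸ 𝟙 (I (∁ X))) ∸ n     ≡⟨ cong₂ _∸_ (cong₂ _+_ (rk-transversal t)
                                                                  (rk-transversal (transversal-∁ t))) rk⊤≡n ⟨
    rk X + rk (∁ X) ∸ rk ⊤                    ∎
    where open ≡-Reasoning
  ... | no ¬t = begin
    λ′ X                                      ≡⟨ Spiky.agrees spiky X ¬t ⟩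
    λn n X                                    ≡⟨ λn≡ X ¬t ⟩
    g X + g (∁ X) ∸ n                         ≡⟨ cong₂ _∸_ (cong₂ _+_ (rk-out (non-transversal∉I ¬t))
                                                   (rk-out (non-transversal∉I (¬t ∘ transversal-∁⁻)))) rk⊤≡n ⟨
    rk X + rk (∁ X) ∸ rk ⊤                    ∎
    where open ≡-Reasoning

module Necessity (m : ℕ) (λ′ : Sub (2 + m) → ℕ) (spiky : Spiky (2 + m) λ′)
                 (M : Matroid (2 + m + (2 + m))) (λ′≡μ : ∀ X → λ′ X ≡ connectivity M X) where
  n : ℕ
  n = 2 + m

  open Legs n
  open Spike n
  open Matroid M
  open Connectivity M

  λ′-partial : ∀ {Z} → k Z ≡ 0 → l n Z < n → λ′ Z ≡ ∣ Z ∣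
  λ′-partial {Z} k≡0 l<n = begin
    λ′ Z                ≡⟨ Spiky.agrees spiky Z ¬t ⟩
    λn n Z              ≡⟨ λn≡ Z ¬t ⟩
    g Z + g (∁ Z) ∸ n   ≡⟨ cong₂ (λ a b → a + b ∸ n) (g-noLeg {Z} k≡0 l<n)
                             (l≡n⇒g≡n {∁ Z} (trans (l∁≡n∸k Z) (cong (n ∸_) k≡0))) ⟩
    ∣ Z ∣ + n ∸ n       ≡⟨ m+n∸n≡m ∣ Z ∣ n ⟩
    ∣ Z ∣               ∎
    where
    open ≡-Reasoning
    ¬t : ¬ Transversal n Z
    ¬t t = <-irrefl (transversal⇒l≡n t) l<n

  partial-independent : ∀ {Z} → k Z ≡ 0 → l n Z < n → rank Z ≡ ∣ Z ∣
  partial-independent {Z} k≡0 l<n =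
    connectivity≡∣X∣⇒independent (trans (sym (λ′≡μ Z)) (λ′-partial k≡0 l<n))

  -- W includes L_0, misses L_1 and meets every other leg once; ∁ W does the
  -- same with L_0 and L_1 exchanged.
  xW yW : Subset n
  xW = inside ∷ outside ∷ ⊤
  yW = inside ∷ outside ∷ ⊥

  W : Sub n
  W = xW ++ yW

  l-W : l n W ≡ suc m
  l-W = trans (l≡∣legsMet∣ W) (trans (cong ∣_∣ legsMet-W) (cong suc (∣⊤∣≡n m)))
    where
    legsMet-W : legsMet W ≡ inside ∷ outside ∷ ⊤
    legsMet-W = trans (cong₂ _∪_ (xs-++ xW yW) (ys-++ xW yW)) (cong (λ p → inside ∷ outside ∷ p) (∪-identityʳ ⊤))

  k-W : k W ≡ 1
  k-W = trans (cong ∣_∣ legsIn-W) (cong suc (∣⊥∣≡0 m))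
    where
    legsIn-W : legsIn W ≡ inside ∷ outside ∷ ⊥
    legsIn-W = trans (cong₂ _∩_ (xs-++ xW yW) (ys-++ xW yW)) (cong (λ p → inside ∷ outside ∷ p) (∩-zeroʳ ⊤))

  ∣oneLeg∣≡n : ∀ X → k X ≡ 1 → l n X ≡ suc m → ∣ X ∣ ≡ n
  ∣oneLeg∣≡n X k≡1 l≡ = trans (∣X∣≡l+k X) (trans (cong₂ _+_ l≡ k≡1) (+-comm (suc m) 1))

  g-oneLeg : ∀ X → k X ≡ 1 → l n X ≡ suc m → g X ≡ n
  g-oneLeg X k≡1 l≡ = trans (g-someLeg {X} (subst (0 <_) (sym k≡1) ≤-refl) (subst (_< n) (sym l≡) ≤-refl))
                               (trans (cong (_+ 1) l≡) (+-comm (suc m) 1))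

  k-∁W : k (∁ W) ≡ 1
  k-∁W = trans (k∁≡n∸l W) (trans (cong (n ∸_) l-W) (m+n∸n≡m 1 m))

  l-∁W : l n (∁ W) ≡ suc m
  l-∁W = trans (l∁≡n∸k W) (cong (n ∸_) k-W)

  λ′-W : λ′ W ≡ n
  λ′-W = begin
    λ′ W                ≡⟨ Spiky.agrees spiky W ¬t ⟩
    λn n W              ≡⟨ λn≡ W ¬t ⟩
    g W + g (∁ W) ∸ n   ≡⟨ cong₂ (λ a b → a + b ∸ n) (g-oneLeg W k-W l-W) (g-oneLeg (∁ W) k-∁W l-∁W) ⟩
    n + n ∸ n           ≡⟨ m+n∸n≡m n n ⟩
    n                   ∎
    where
    open ≡-Reasoning
    ¬t : ¬ Transversal n W
    ¬t t = 1+n≢0 (trans (sym k-W) (transversal⇒k≡0 t))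

  -- W is independent and ∁ W is spanning, so M has rank n.
  rank-W : rank W ≡ n
  rank-W = trans (connectivity≡∣X∣⇒independent (trans (sym (λ′≡μ W)) (trans λ′-W (sym ∣W∣≡n)))) ∣W∣≡n
    where
    ∣W∣≡n : ∣ W ∣ ≡ n
    ∣W∣≡n = ∣oneLeg∣≡n W k-W l-W

  rank⊤≡n : rank ⊤ ≡ n
  rank⊤≡n = ≤-antisym rank⊤≤n (subst (_≤ rank ⊤) rank-W (rank-mono W ⊤ ⊆⊤))
    where
    rank∁W≡rank⊤ : rank (∁ W) ≡ rank ⊤
    rank∁W≡rank⊤ = connectivity≡rank⇒∁spanning (trans (sym (λ′≡μ W)) (trans λ′-W (sym rank-W)))
                     (subst (0 <_) (sym rank-W) (s≤s z≤n))
    rank⊤≤n : rank ⊤ ≤ n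
    rank⊤≤n = subst₂ _≤_ rank∁W≡rank⊤ (∣oneLeg∣≡n (∁ W) k-∁W l-∁W) (rank-card (∁ W))

  -- A transversal has rank n - 1 or n: removing a leg leaves n - 1 independent elements.
  rank-transversal-≥ : ∀ {X} → Transversal n X → n ∸ 1 ≤ rank X
  rank-transversal-≥ {X} t = begin
    n ∸ 1       ≡⟨ l[transversal−leg] zero t ⟨
    l n Z       ≡⟨ k≡0⇒l≡∣X∣ {Z} k≡0 ⟩
    ∣ Z ∣       ≡⟨ partial-independent {Z} k≡0 (subst (_< n) (sym (l[transversal−leg] zero t)) ≤-refl) ⟨
    rank Z      ≤⟨ rank-mono Z X (p∩q⊆p X (withoutLeg zero)) ⟩
    rank X      ∎
    where
    open ≤-Reasoning
    Z = X ∩ withoutLeg zero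
    k≡0 : k Z ≡ 0
    k≡0 = k≡0-⊆transversal t (p∩q⊆p X (withoutLeg zero))

  rank-transversal-≤ : ∀ {X} → Transversal n X → rank X ≤ n
  rank-transversal-≤ {X} t = subst (rank X ≤_) (∣transversal∣≡n t) (rank-card X)

  I : Sub n → Bool
  I X = ⌊ transversal? X ×-dec rank X <? n ⌋

  rank-transversal : ∀ {X} → Transversal n X → rank X ≡ n ∸ 𝟙 (I X)
  rank-transversal {X} t with transversal? X | rank X <? n
  ... | no ¬t | _       = contradiction t ¬t
  ... | yes _ | yes r<n = ≤-antisym (<⇒≤pred r<n) (rank-transversal-≥ t)
  ... | yes _ | no  r≮n = ≤-antisym (rank-transversal-≤ t) (≮⇒≥ r≮n)

  I⇒transversal : ∀ {X} → I X ≡ true → Transversal n X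
  I⇒transversal {X} with transversal? X | rank X <? n
  ... | yes t | yes _ = λ _ → t
  ... | yes _ | no  _ = λ ()
  ... | no  _ | _     = λ ()

  rank-I : ∀ {X} → I X ≡ true → rank X ≡ n ∸ 1
  rank-I {X} X∈I = trans (rank-transversal (I⇒transversal X∈I)) (cong (λ b → n ∸ 𝟙 b) X∈I)

  values : ∀ X → Transversal n X → λ′ X ≡ n ∸ countIn n I X
  values X t = begin
    λ′ X                                      ≡⟨ λ′≡μ X ⟩
    rank X + rank (∁ X) ∸ rank ⊤              ≡⟨ cong₂ _∸_ (cong₂ _+_ (rank-transversal t)
                                                                  (rank-transversal (transversal-∁ t))) rank⊤≡n ⟩
    (n ∸ 𝟙 (I X)) + (n ∸ 𝟙 (I (∁ X))) ∸ n     ≡⟨ ∸-indicators n (I X) (I (∁ X)) ⟩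
    n ∸ (𝟙 (I X) + 𝟙 (I (∁ X)))               ∎
    where open ≡-Reasoning

  -- Two adjacent transversals X, Y cannot both have rank n - 1: by
  -- submodularity X ∪ Y would have rank at most n - 1, whereas the
  -- connectivity of X ∪ Y (equal to that of its complement, a partial
  -- transversal of size n - 1) forces rank n.
  adjacent-not-both : ∀ X Y → I X ≡ true → I Y ≡ true → ¬ Adjacent n X Y
  adjacent-not-both X Y X∈I Y∈I adj@(tX , tY , _) =
    <-irrefl refl (subst (_≤ m) λ′U≡1+m λ′U≤m)
    where
    U = X ∪ Y
    N = X ∩ Y
    kN≡0 : k N ≡ 0
    kN≡0 = k≡0-⊆transversal tX (p∩q⊆p X Y)
    ∣N∣≡1+m : ∣ N ∣ ≡ suc m
    ∣N∣≡1+m = +-cancelʳ-≡ 1 ∣ N ∣ (suc m) (trans (∣∩∣-adjacent adj) (+-comm 1 (suc m)))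
    rankN≡1+m : rank N ≡ suc m
    rankN≡1+m = trans (partial-independent {N} kN≡0 (subst (_< n) (sym (trans (k≡0⇒l≡∣X∣ {N} kN≡0) ∣N∣≡1+m)) ≤-refl))
                      ∣N∣≡1+m
    rankU≤1+m : rank U ≤ suc m
    rankU≤1+m = +-cancelʳ-≤ (suc m) (rank U) (suc m) (begin
      rank U + suc m          ≡⟨ cong (rank U +_) rankN≡1+m ⟨
      rank U + rank N         ≤⟨ rank-submod X Y ⟩
      rank X + rank Y         ≡⟨ cong₂ _+_ (rank-I X∈I) (rank-I Y∈I) ⟩
      suc m + suc m           ∎)
      where open ≤-Reasoning
    lU≡n : l n U ≡ n
    lU≡n = ≤-antisym (l≤n U) (subst (_≤ l n U) (transversal⇒l≡n tX) (l-mono (p⊆p∪q {p = X} Y)))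
    kU≡1 : k U ≡ 1
    kU≡1 = +-cancelˡ-≡ n (k U) 1 (begin
      n + k U                 ≡⟨ cong (_+ k U) lU≡n ⟨
      l n U + k U             ≡⟨ ∣X∣≡l+k U ⟨
      ∣ U ∣                   ≡⟨ ∣∪∣-adjacent adj ⟩
      1 + n                   ≡⟨ +-comm 1 n ⟩
      n + 1                   ∎)
      where open ≡-Reasoning
    k∁U≡0 : k (∁ U) ≡ 0
    k∁U≡0 = trans (k∁≡n∸l U) (trans (cong (n ∸_) lU≡n) (n∸n≡0 n))
    l∁U≡1+m : l n (∁ U) ≡ suc m
    l∁U≡1+m = trans (l∁≡n∸k U) (cong (n ∸_) kU≡1)
    ∣∁U∣≡1+m : ∣ ∁ U ∣ ≡ suc m
    ∣∁U∣≡1+m = trans (sym (k≡0⇒l≡∣X∣ {∁ U} k∁U≡0)) l∁U≡1+m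
    l∁U<n : l n (∁ U) < n
    l∁U<n = subst (_< n) (sym l∁U≡1+m) ≤-refl
    λ′U≡1+m : λ′ U ≡ suc m
    λ′U≡1+m = trans (Spiky.symmetric spiky U) (trans (λ′-partial {∁ U} k∁U≡0 l∁U<n) ∣∁U∣≡1+m)
    λ′U≤m : λ′ U ≤ m
    λ′U≤m = begin
      λ′ U                                ≡⟨ λ′≡μ U ⟩
      rank U + rank (∁ U) ∸ rank ⊤        ≡⟨ cong₂ (λ a b → rank U + a ∸ b)
                                               (trans (partial-independent {∁ U} k∁U≡0 l∁U<n) ∣∁U∣≡1+m) rank⊤≡n ⟩
      rank U + suc m ∸ n                  ≤⟨ ∸-monoˡ-≤ n (+-monoˡ-≤ (suc m) rankU≤1+m) ⟩
      suc m + suc m ∸ n                   ≡⟨ m+n∸n≡m m (suc m) ⟩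
      m                                   ∎
      where open ≤-Reasoning

  I-independent : IsIndependent n I
  I-independent = (λ X → I⇒transversal {X}) , adjacent-not-both

necessity : ∀ m (λ′ : Sub (2 + m) → ℕ) → Spiky (2 + m) λ′ →
  Σ (Matroid (2 + m + (2 + m))) (λ M → ∀ X → λ′ X ≡ connectivity M X) →
  Σ (Sub (2 + m) → Bool) (λ I → IsIndependent (2 + m) I ×
    (∀ X → Transversal (2 + m) X → λ′ X ≡ (2 + m) ∸ countIn (2 + m) I X))
necessity m λ′ spiky (M , λ′≡μ) = I , I-independent , values
  where open Necessity m λ′ spiky M λ′≡μ

sufficiency : ∀ n → 0 < n → (λ′ : Sub n → ℕ) → Spiky n λ′ →
  Σ (Sub n → Bool) (λ I → IsIndependent n I ×
    (∀ X → Transversal n X → λ′ X ≡ n ∸ countIn n I X)) →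
  Σ (Matroid (n + n)) (λ M → ∀ X → λ′ X ≡ connectivity M X)
sufficiency n 0<n λ′ spiky (I , I-independent , on-T) = Tightened.tightened , connectivity-tightened λ′ spiky on-T
  where open Sufficiency n 0<n I I-independent

corollary1 : (n : ℕ) → 3 ≤ n → (λ′ : Sub n → ℕ) → Spiky n λ′ →
    (Σ (Matroid (n + n)) (λ M → ∀ X → λ′ X ≡ connectivity M X))
      ⇔ (Σ (Sub n → Bool) (λ I → IsIndependent n I ×
           (∀ X → Transversal n X → λ′ X ≡ n ∸ countIn n I X)))
corollary1 (suc (suc m)) (s≤s (s≤s _)) λ′ spiky =
  mk⇔ (necessity m λ′ spiky) (sufficiency (2 + m) (s≤s z≤n) λ′ spiky)
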